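{- Let $\mathcal{A}$ be a mass problem that is not of finite degree, and let $\mathcal{B}$ be a mass problem with $\mathcal{B}\not\le_M\mathcal{A}$. Then there exist mass problems $\mathcal{C}_0,\mathcal{C}_1$ with $\mathcal{A}\le_M\mathcal{C}_0$, $\mathcal{A}\le_M\mathcal{C}_1$, $\mathcal{C}_0$ and $\mathcal{C}_1$ $\le_M$-incomparable, $\mathcal{B}\not\le_M\mathcal{C}_0$ and $\mathcal{B}\not\le_M\mathcal{C}_1$.
   Context: A mass problem is a subset of Baire space $\omega^\omega$. $\mathcal{A}\le_M\mathcal{B}$ iff there is a partial Turing functional $\Psi$ such that for every $f\in\mathcal{B}$, $\Psi(f)$ is defined and $\Psi(f)\in\mathcal{A}$; $\equiv_M$ is the induced equivalence. A mass problem is of finite degree if it is $\equiv_M$-equivalent to some finite mass problem. -}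

module Defs where

open import Level using (0ℓ)
open import Data.Nat using (ℕ; zero; suc)
open import Data.Fin using (Fin)
open import Data.Vec using (Vec; []; _∷_; lookup)
open import Data.List using (List)
open import Data.List.Relation.Unary.Any using (Any)
open import Data.Product using (Σ; ∃; _×_; _,_)
open import Relation.Binary.PropositionalEquality using (_≡_)
open import Relation.Nullary using (¬_)
open import Relation.Unary using (Pred)

Baire : Set
Baire = ℕ → ℕ

MassProblem : Set₁
MassProblem = Pred Baire 0ℓ

-- Oracle partial recursive functions (Kleene's μ-recursive functions
-- relative to an oracle f : ℕ → ℕ).  PR k = codes of k-ary functions.

data PR : ℕ → Set where
  zeroF   : ∀ {k} → PR k
  succF   : PR 1
  projF   : ∀ {k} → Fin k → PR k
  oracleF : PR 1
  compF   : ∀ {k m} → PR m → Vec (PR k) m → PR k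
  recF    : ∀ {k} → PR k → PR (suc (suc k)) → PR (suc k)
  minF    : ∀ {k} → PR (suc k) → PR k

-- Big-step semantics relative to oracle f:  Eval f P xs y  means  P^f(xs)↓ = y.
mutual
  data Eval (f : Baire) : ∀ {k} → PR k → Vec ℕ k → ℕ → Set where
    ev-zero   : ∀ {k} {xs : Vec ℕ k} → Eval f zeroF xs 0
    ev-succ   : ∀ {x} → Eval f succF (x ∷ []) (suc x)
    ev-proj   : ∀ {k} {i : Fin k} {xs} → Eval f (projF i) xs (lookup xs i)
    ev-oracle : ∀ {x} → Eval f oracleF (x ∷ []) (f x)
    ev-comp   : ∀ {k m} {g : PR m} {hs : Vec (PR k) m} {xs ys y} →
                EvalAll f hs xs ys → Eval f g ys y → Eval f (compF g hs) xs y
    ev-rec0   : ∀ {k} {g : PR k} {h : PR (suc (suc k))} {xs y} →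
                Eval f g xs y → Eval f (recF g h) (0 ∷ xs) y
    ev-recS   : ∀ {k} {g : PR k} {h : PR (suc (suc k))} {n xs z y} →
                Eval f (recF g h) (n ∷ xs) z → Eval f h (n ∷ z ∷ xs) y →
                Eval f (recF g h) (suc n ∷ xs) y
    ev-min    : ∀ {k} {g : PR (suc k)} {xs n} →
                Eval f g (n ∷ xs) 0 →
                (∀ (m : Fin n) → Σ ℕ λ v → Eval f g (Data.Fin.toℕ m ∷ xs) (suc v)) →
                Eval f (minF g) xs n

  data EvalAll (f : Baire) {k : ℕ} : ∀ {m} → Vec (PR k) m → Vec ℕ k → Vec ℕ m → Set where
    []  : ∀ {xs} → EvalAll f [] xs []
    _∷_ : ∀ {m} {h : PR k} {hs : Vec (PR k) m} {xs y ys} →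
          Eval f h xs y → EvalAll f hs xs ys → EvalAll f (h ∷ hs) xs (y ∷ ys)

-- A partial Turing functional is given by a unary oracle program Ψ;
-- Ψ(f) is defined and equals g iff Ψ^f(n)↓ = g(n) for every n.
TuringFunctional : Set
TuringFunctional = PR 1

_computes_from_ : TuringFunctional → Baire → Baire → Set
Ψ computes g from f = ∀ n → Eval f Ψ (n ∷ []) (g n)

_≤M_ : MassProblem → MassProblem → Set
A ≤M B = Σ TuringFunctional λ Ψ → ∀ f → B f → Σ Baire λ g → (Ψ computes g from f) × A g

_≡M_ : MassProblem → MassProblem → Set
A ≡M B = (A ≤M B) × (B ≤M A)

finiteMP : List Baire → MassProblem
finiteMP L g = Any (λ h → ∀ n → h n ≡ g n) L

FiniteDegree : MassProblem → Set
FiniteDegree A = Σ (List Baire) λ L → A ≡M finiteMP L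

Incomparable : MassProblem → MassProblem → Set
Incomparable C D = ¬ (C ≤M D) × ¬ (D ≤M C)

{-# OPTIONS --safe #-}
module Submission where

-- C₀ and C₁ are unions of finite subsets of A growing in stages. Each side i carries a
-- shrinking pool Xᵢ ⊆ A containing all present and future members of Cᵢ and staying big:
-- B ≰M Xᵢ and no finite subset of A is ≤M Xᵢ (initially Xᵢ = A, big by the hypotheses).
-- Each functional Ψ is met at some stage: side i gains a member f with Ψ(f) ∉ B, and
-- side 1-i a member b while Xᵢ shrinks to exclude Ψ(b); so Ψ reduces neither B to Cᵢ
-- nor Cᵢ to C₁₋ᵢ. Such b exists, for otherwise Ψ maps X₁₋ᵢ into Xᵢ, onto a set not
-- contained in any finite subset of A (as X₁₋ᵢ is big), each of whose points g outside the
-- current members makes Xᵢ ∖ {g} small (else Xᵢ ∖ {g} would do). But if Xᵢ ∖ {g} and Xᵢ ∖ {g′} are small in the same way for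
-- g ≠ g′, then so is Xᵢ: choose between the two reductions by reading the input at a
-- point where g and g′ differ.

open import Defs
open import Level using (0ℓ; lift; lower)
open import Axiom.ExcludedMiddle using (ExcludedMiddle)
open import Axiom.DoubleNegationElimination using (em⇒dne)
open import Data.Empty using (⊥; ⊥-elim)
open import Data.Fin as Fin using (Fin; toℕ; fromℕ<)
open import Data.Fin.Properties using (toℕ-fromℕ<)
open import Data.List using (List; []; _∷_; _++_; map; concatMap; cartesianProductWith; upTo; allFin)
open import Data.List.Membership.Propositional using (_∈_; find; lose)
open import Data.List.Membership.Propositional.Properties
  using (∈-++⁺ˡ; ∈-++⁺ʳ; ∈-++⁻; ∈-map⁺; ∈-concatMap⁺; ∈-cartesianProductWith⁺; ∈-upTo⁺; ∈-allFin)
open import Data.List.Relation.Unary.Any using (here; there)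
open import Data.List.Relation.Unary.Any.Properties using (++⁺ˡ; ++⁺ʳ)
open import Data.Nat using (ℕ; zero; suc; _+_; _≤_; _<_; _≤′_; ≤′-refl; ≤′-step; _⊔_; _≟_; s≤s)
open import Data.Nat.Properties
  using (0≢1+n; ≤-antisym; ≮⇒≥; +-identityʳ; ≤-refl; ≤-trans; m≤m⊔n; m≤n⊔m; ≤⇒≤′)
open import Data.Product using (Σ; ∃; _×_; _,_; proj₁; proj₂; map₂; swap)
open import Data.Sum using (_⊎_; inj₁; inj₂; [_,_])
open import Data.Vec using (Vec; []; _∷_)
open import Function using (id; _∘_)
open import Relation.Binary.PropositionalEquality
  using (_≡_; _≢_; _≗_; refl; sym; trans; cong; cong₂; subst)
open import Relation.Nullary using (¬_; yes; no)
open import Relation.Unary using (_⊆_; _∪_; _∖_)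

mutual
  eval-deterministic : ∀ {f k} {P : PR k} {xs y y′} →
                       Eval f P xs y → Eval f P xs y′ → y ≡ y′
  eval-deterministic ev-zero   ev-zero   = refl
  eval-deterministic ev-succ   ev-succ   = refl
  eval-deterministic ev-proj   ev-proj   = refl
  eval-deterministic ev-oracle ev-oracle = refl
  eval-deterministic (ev-comp as d) (ev-comp as′ d′)
    with refl ← evalAll-deterministic as as′ = eval-deterministic d d′
  eval-deterministic (ev-rec0 d) (ev-rec0 d′) = eval-deterministic d d′
  eval-deterministic (ev-recS d e) (ev-recS d′ e′)
    with refl ← eval-deterministic d d′ = eval-deterministic e e′
  eval-deterministic (ev-min z h) (ev-min z′ h′) =
    ≤-antisym (≮⇒≥ (μ-no-earlier-zero z′ h)) (≮⇒≥ (μ-no-earlier-zero z h′))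

  evalAll-deterministic : ∀ {f k m} {Ps : Vec (PR k) m} {xs ys ys′} →
                          EvalAll f Ps xs ys → EvalAll f Ps xs ys′ → ys ≡ ys′
  evalAll-deterministic []       []         = refl
  evalAll-deterministic (d ∷ ds) (d′ ∷ ds′) =
    cong₂ _∷_ (eval-deterministic d d′) (evalAll-deterministic ds ds′)

  μ-no-earlier-zero : ∀ {f k} {g : PR (suc k)} {xs m n} → Eval f g (m ∷ xs) 0 →
                      (∀ (i : Fin n) → Σ ℕ λ v → Eval f g (toℕ i ∷ xs) (suc v)) → ¬ m < n
  μ-no-earlier-zero z positive m<n with v , g[m]>0 ← positive (fromℕ< m<n) =
    0≢1+n (eval-deterministic z (subst (λ i → Eval _ _ (i ∷ _) (suc v)) (toℕ-fromℕ< m<n) g[m]>0))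

computes-unique : ∀ {Ψ f g g′} → Ψ computes g from f → Ψ computes g′ from f → g ≗ g′
computes-unique c c′ n = eval-deterministic (c n) (c′ n)

constP : ∀ {k} → ℕ → PR k
constP zero    = zeroF
constP (suc c) = compF succF (constP c ∷ [])

eval-constP : ∀ {f k} {xs : Vec ℕ k} c → Eval f (constP c) xs c
eval-constP zero    = ev-zero
eval-constP (suc c) = ev-comp (eval-constP c ∷ []) ev-succ

δ : ℕ → ℕ → ℕ
δ zero    zero    = 1
δ zero    (suc x) = 0
δ (suc c) zero    = 0
δ (suc c) (suc x) = δ c x

δ-diag : ∀ c → δ c c ≡ 1
δ-diag zero    = refl
δ-diag (suc c) = δ-diag c

δ-off : ∀ c x → x ≢ c → δ c x ≡ 0
δ-off zero    zero    x≢c = ⊥-elim (x≢c refl)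
δ-off zero    (suc x) x≢c = refl
δ-off (suc c) zero    x≢c = refl
δ-off (suc c) (suc x) x≢c = δ-off c x (x≢c ∘ cong suc)

δP : ℕ → PR 1
δP zero    = recF (constP 1) zeroF
δP (suc c) = recF (constP 0) (compF (δP c) (projF Fin.zero ∷ []))

eval-δP : ∀ {f} c x → Eval f (δP c) (x ∷ []) (δ c x)
eval-δP zero    zero    = ev-rec0 (eval-constP 1)
eval-δP zero    (suc x) = ev-recS (eval-δP zero x) ev-zero
eval-δP (suc c) zero    = ev-rec0 (eval-constP 0)
eval-δP (suc c) (suc x) = ev-recS (eval-δP (suc c) x) (ev-comp (ev-proj ∷ []) (eval-δP c x))

addP : PR 2
addP = recF (projF Fin.zero) (compF succF (projF (Fin.suc Fin.zero) ∷ []))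

eval-addP : ∀ {f} x y → Eval f addP (x ∷ y ∷ []) (x + y)
eval-addP zero    y = ev-rec0 ev-proj
eval-addP (suc x) y = ev-recS (eval-addP x y) (ev-comp (ev-proj ∷ []) ev-succ)

-- guardP Ψ (0, n) = 0 without running Ψ, and guardP Ψ (1, n) = Ψ(n).
guardP : PR 1 → PR 2
guardP Ψ = recF zeroF (compF Ψ (projF (Fin.suc (Fin.suc Fin.zero)) ∷ []))

eval-guardP-0 : ∀ {f Ψ n} → Eval f (guardP Ψ) (0 ∷ n ∷ []) 0
eval-guardP-0 = ev-rec0 ev-zero

eval-guardP-1 : ∀ {f Ψ n y} → Eval f Ψ (n ∷ []) y → Eval f (guardP Ψ) (1 ∷ n ∷ []) y
eval-guardP-1 d = ev-recS eval-guardP-0 (ev-comp (ev-proj ∷ []) d)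

-- guardP Ψ₁ (T n, n) + guardP Ψ₀ (δ 0 (T n), n): only the selected branch has to converge.
selectP : PR 1 → PR 1 → PR 1 → PR 1
selectP T Ψ₀ Ψ₁ = compF addP
  ( compF (guardP Ψ₁) (T ∷ projF Fin.zero ∷ [])
  ∷ compF (guardP Ψ₀) (compF (δP 0) (T ∷ []) ∷ projF Fin.zero ∷ [])
  ∷ [])

eval-selectP-0 : ∀ {f T Ψ₀ Ψ₁ n y} → Eval f T (n ∷ []) 0 → Eval f Ψ₀ (n ∷ []) y →
                 Eval f (selectP T Ψ₀ Ψ₁) (n ∷ []) y
eval-selectP-0 {y = y} t d = ev-comp
  ( ev-comp (t ∷ ev-proj ∷ []) eval-guardP-0
  ∷ ev-comp (ev-comp (t ∷ []) (eval-δP 0 0) ∷ ev-proj ∷ []) (eval-guardP-1 d)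
  ∷ [])
  (eval-addP 0 y)

eval-selectP-1 : ∀ {f T Ψ₀ Ψ₁ n y} → Eval f T (n ∷ []) 1 → Eval f Ψ₁ (n ∷ []) y →
                 Eval f (selectP T Ψ₀ Ψ₁) (n ∷ []) y
eval-selectP-1 {f} {y = y} t d = ev-comp
  ( ev-comp (t ∷ ev-proj ∷ []) (eval-guardP-1 d)
  ∷ ev-comp (ev-comp (t ∷ []) (eval-δP 0 1) ∷ ev-proj ∷ []) eval-guardP-0
  ∷ [])
  (subst (Eval f addP (y ∷ 0 ∷ [])) (+-identityʳ y) (eval-addP y 0))

oracle-testP : ℕ → ℕ → PR 1
oracle-testP N a = compF (δP a) (compF oracleF (constP N ∷ []) ∷ [])

eval-oracle-testP : ∀ {f} N a {x} → Eval f (oracle-testP N a) (x ∷ []) (δ a (f N))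
eval-oracle-testP {f} N a = ev-comp (ev-comp (eval-constP N ∷ []) ev-oracle ∷ []) (eval-δP a (f N))

eval-oracle-testP-≡ : ∀ {f N a x} → f N ≡ a → Eval f (oracle-testP N a) (x ∷ []) 1
eval-oracle-testP-≡ {f} {N} {a} refl = subst (Eval f _ _) (δ-diag a) (eval-oracle-testP N a)

eval-oracle-testP-≢ : ∀ {f N a x} → f N ≢ a → Eval f (oracle-testP N a) (x ∷ []) 0
eval-oracle-testP-≢ {f} {N} {a} fN≢a = subst (Eval f _ _) (δ-off a (f N) fN≢a) (eval-oracle-testP N a)

_⟨_⟩∉_ : TuringFunctional → Baire → MassProblem → Set
Ψ ⟨ f ⟩∉ M = ∀ g → Ψ computes g from f → ¬ M g

⊆⇒≤M : ∀ {M Y : MassProblem} → Y ⊆ M → M ≤M Y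
⊆⇒≤M Y⊆M = oracleF , λ f Yf → f , (λ n → ev-oracle) , Y⊆M Yf

finite⇒≤M : ∀ {M : MassProblem} {L} → (_∈ L) ⊆ M → M ≤M finiteMP L
finite⇒≤M {M} {L} L⊆M = oracleF , reduce
  where
  reduce : ∀ g → finiteMP L g → Σ Baire λ h → (oracleF computes h from g) × M h
  reduce g g∈L with h , h∈L , h≗g ← find g∈L =
    h , (λ n → subst (Eval g oracleF (n ∷ [])) (sym (h≗g n)) ev-oracle) , L⊆M h∈L

≤M-monoˡ : ∀ {M M′ Y : MassProblem} → M ⊆ M′ → M ≤M Y → M′ ≤M Y
≤M-monoˡ M⊆M′ (Ψ , reduce) = Ψ , λ f Yf →
  let g , Ψf↦g , Mg = reduce f Yf in g , Ψf↦g , M⊆M′ Mg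

-- Reading f(N) tells which of g, g′ the input f is certainly not.
≤M-glue : ∀ {Y M M′ : MassProblem} {g g′ : Baire} N → g N ≢ g′ N →
          M ≤M (Y ∖ (g ≗_)) → M′ ≤M (Y ∖ (g′ ≗_)) → (M ∪ M′) ≤M Y
≤M-glue {Y} {M} {M′} {g} {g′} N gN≢g′N (Ψ , reduce) (Ψ′ , reduce′) = Φ , reduce-glued
  where
  Φ : TuringFunctional
  Φ = selectP (oracle-testP N (g N)) Ψ Ψ′

  reduce-glued : ∀ f → Y f → Σ Baire λ h → (Φ computes h from f) × (M ∪ M′) h
  reduce-glued f Yf with f N ≟ g N
  ... | yes fN≡gN =
    let h , Ψ′f↦h , M′h = reduce′ f (Yf , λ g′≗f → gN≢g′N (trans (sym fN≡gN) (sym (g′≗f N))))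
    in h , (λ n → eval-selectP-1 (eval-oracle-testP-≡ fN≡gN) (Ψ′f↦h n)) , inj₂ M′h
  ... | no fN≢gN =
    let h , Ψf↦h , Mh = reduce f (Yf , λ g≗f → fN≢gN (sym (g≗f N)))
    in h , (λ n → eval-selectP-0 (eval-oracle-testP-≢ fN≢gN) (Ψf↦h n)) , inj₁ Mh

Eventually : (ℕ → Set) → Set
Eventually P = ∃ λ s → ∀ t → s ≤ t → P t

always : ∀ {P : ℕ → Set} → (∀ t → P t) → Eventually P
always p = 0 , λ t _ → p t

eventually-× : ∀ {P Q : ℕ → Set} → Eventually P → Eventually Q → Eventually (λ t → P t × Q t)
eventually-× (s , p) (s′ , q) =
  s ⊔ s′ , λ t le → p t (≤-trans (m≤m⊔n s s′) le) , q t (≤-trans (m≤n⊔m s s′) le)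

eventually-map : ∀ {P Q : ℕ → Set} → (∀ t → P t → Q t) → Eventually P → Eventually Q
eventually-map P⇒Q (s , p) = s , λ t le → P⇒Q t (p t le)

vectorsOver : ∀ {A : Set} m → List A → List (Vec A m)
vectorsOver zero    xs = [] ∷ []
vectorsOver (suc m) xs = cartesianProductWith _∷_ xs (vectorsOver m xs)

primitives : ∀ k → List (PR k)
primitives k = zeroF ∷ map projF (allFin k) ++ unaryPrimitives k
  where
  unaryPrimitives : ∀ k → List (PR k)
  unaryPrimitives 1 = succF ∷ oracleF ∷ []
  unaryPrimitives _ = []

compositionsOfArity : (∀ k → List (PR k)) → ∀ k m → List (PR k)
compositionsOfArity ps k m = cartesianProductWith compF (ps m) (vectorsOver m (ps k))

compositions : ℕ → (∀ k → List (PR k)) → ∀ k → List (PR k)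
compositions s ps k = concatMap (compositionsOfArity ps k) (upTo s)

recursions : (∀ k → List (PR k)) → ∀ k → List (PR k)
recursions ps zero    = []
recursions ps (suc k) = cartesianProductWith recF (ps k) (ps (suc (suc k)))

-- Inner arities of compositions are bounded by s to keep the list finite.
nextPrograms : ℕ → (∀ k → List (PR k)) → ∀ k → List (PR k)
nextPrograms s ps k =
  primitives k ++ compositions s ps k ++ recursions ps k ++ map minF (ps (suc k))

programs : ℕ → ∀ k → List (PR k)
programs zero    k = []
programs (suc s) k = programs s k ++ nextPrograms s (programs s) k

eventually-in-programs : ∀ {k} {P : PR k} →
  Eventually (λ t → P ∈ nextPrograms t (programs t) k) → Eventually (λ t → P ∈ programs t k)
eventually-in-programs (s , P∈) = suc s , λ { (suc t) (s≤s le) → ∈-++⁺ʳ (programs t _) (P∈ t le) }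

primitive-complete : ∀ {k} {P : PR k} → P ∈ primitives k → Eventually (λ t → P ∈ programs t k)
primitive-complete P∈ = eventually-in-programs (always λ t → ∈-++⁺ˡ P∈)

mutual
  programs-complete : ∀ {k} (P : PR k) → Eventually (λ t → P ∈ programs t k)
  programs-complete zeroF = primitive-complete (here refl)
  programs-complete (projF i) = primitive-complete (there (∈-++⁺ˡ (∈-map⁺ projF (∈-allFin i))))
  programs-complete succF     = primitive-complete (there (there (here refl)))
  programs-complete oracleF   = primitive-complete (there (there (there (here refl))))
  programs-complete {k} (compF {m = m} g hs) = eventually-in-programs (eventually-map
    (λ t (m<t , g∈ , hs∈) → ∈-++⁺ʳ (primitives k) (∈-++⁺ˡ
      (∈-concatMap⁺ (compositionsOfArity (programs t) k)
        (lose (∈-upTo⁺ m<t) (∈-cartesianProductWith⁺ compF g∈ hs∈)))))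
    (eventually-× (suc m , λ t m<t → m<t) (eventually-× (programs-complete g) (vector-complete hs))))
  programs-complete {suc k} (recF g h) = eventually-in-programs (eventually-map
    (λ t (g∈ , h∈) → ∈-++⁺ʳ (primitives (suc k)) (∈-++⁺ʳ (compositions t (programs t) (suc k))
      (∈-++⁺ˡ (∈-cartesianProductWith⁺ recF g∈ h∈))))
    (eventually-× (programs-complete g) (programs-complete h)))
  programs-complete {k} (minF g) = eventually-in-programs (eventually-map
    (λ t g∈ → ∈-++⁺ʳ (primitives k) (∈-++⁺ʳ (compositions t (programs t) k)
      (∈-++⁺ʳ (recursions (programs t) k) (∈-map⁺ minF g∈))))
    (programs-complete g))

  vector-complete : ∀ {k m} (Ps : Vec (PR k) m) → Eventually (λ t → Ps ∈ vectorsOver m (programs t k))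
  vector-complete []       = always λ t → here refl
  vector-complete (P ∷ Ps) = eventually-map
    (λ t (P∈ , Ps∈) → ∈-cartesianProductWith⁺ _∷_ P∈ Ps∈)
    (eventually-× (programs-complete P) (vector-complete Ps))

module Construction (em : ExcludedMiddle (Level.suc 0ℓ)) (A B : MassProblem)
                    (A-not-finite : ¬ FiniteDegree A) (B≰A : ¬ B ≤M A) where

  dne₁ : {P : Set₁} → ¬ ¬ P → P
  dne₁ = em⇒dne em

  dne : {P : Set} → ¬ ¬ P → P
  dne ¬¬p = lower (dne₁ λ ¬p → ¬¬p (¬p ∘ lift))

  ¬≗⇒∃≢ : ∀ {g g′ : Baire} → ¬ g ≗ g′ → ∃ λ N → g N ≢ g′ N
  ¬≗⇒∃≢ g≉g′ = dne λ none → g≉g′ λ n → dne λ gn≢g′n → none (n , gn≢g′n)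

  ≰M⇒witness : ∀ {M Y : MassProblem} → ¬ M ≤M Y → ∀ Ψ → Σ Baire λ f → Y f × Ψ ⟨ f ⟩∉ M
  ≰M⇒witness M≰Y Ψ = dne λ none → M≰Y (Ψ , λ f Yf →
    dne λ ¬out → none (f , Yf , λ g Ψf↦g Mg → ¬out (g , Ψf↦g , Mg)))

  FiniteBelow : MassProblem → Set
  FiniteBelow Y = Σ (List Baire) λ L → (_∈ L) ⊆ A × finiteMP L ≤M Y

  Big : MassProblem → Set
  Big Y = ¬ B ≤M Y × ¬ FiniteBelow Y

  Small : MassProblem → Set
  Small Y = B ≤M Y ⊎ FiniteBelow Y

  big-A : Big A
  big-A = B≰A , λ (L , L⊆A , L≤A) → A-not-finite (L , finite⇒≤M L⊆A , L≤A)

  ¬big⇒small : ∀ {Y} → ¬ Big Y → Small Y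
  ¬big⇒small ¬big = dne λ ¬small → ¬big (¬small ∘ inj₁ , ¬small ∘ inj₂)

  B≤M-removal-unique : ∀ {Y g g′} → Big Y → ¬ g ≗ g′ →
                       B ≤M (Y ∖ (g ≗_)) → ¬ B ≤M (Y ∖ (g′ ≗_))
  B≤M-removal-unique (B≰Y , _) g≉g′ B≤Y∖g B≤Y∖g′ =
    let N , gN≢g′N = ¬≗⇒∃≢ g≉g′
    in B≰Y (≤M-monoˡ [ id , id ] (≤M-glue N gN≢g′N B≤Y∖g B≤Y∖g′))

  FiniteBelow-removal-unique : ∀ {Y g g′} → Big Y → ¬ g ≗ g′ →
                               FiniteBelow (Y ∖ (g ≗_)) → ¬ FiniteBelow (Y ∖ (g′ ≗_))
  FiniteBelow-removal-unique (_ , ¬finite) g≉g′ (L , L⊆A , L≤Y∖g) (L′ , L′⊆A , L′≤Y∖g′) =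
    let N , gN≢g′N = ¬≗⇒∃≢ g≉g′
    in ¬finite (L ++ L′ , [ L⊆A , L′⊆A ] ∘ ∈-++⁻ L ,
                ≤M-monoˡ [ ++⁺ˡ , ++⁺ʳ L ] (≤M-glue N gN≢g′N L≤Y∖g L′≤Y∖g′))

  -- By pigeonhole, two of the three removals make Y small in the same way.
  at-most-two-collapsing : ∀ {Y g₁ g₂ g₃} → Big Y →
    ¬ g₁ ≗ g₂ → ¬ g₁ ≗ g₃ → ¬ g₂ ≗ g₃ →
    Small (Y ∖ (g₁ ≗_)) → Small (Y ∖ (g₂ ≗_)) → Small (Y ∖ (g₃ ≗_)) → ⊥
  at-most-two-collapsing big d₁₂ d₁₃ d₂₃ (inj₁ B₁) (inj₁ B₂) _ = B≤M-removal-unique big d₁₂ B₁ B₂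
  at-most-two-collapsing big d₁₂ d₁₃ d₂₃ (inj₂ L₁) (inj₂ L₂) _ = FiniteBelow-removal-unique big d₁₂ L₁ L₂
  at-most-two-collapsing big d₁₂ d₁₃ d₂₃ (inj₁ B₁) (inj₂ L₂) (inj₁ B₃) = B≤M-removal-unique big d₁₃ B₁ B₃
  at-most-two-collapsing big d₁₂ d₁₃ d₂₃ (inj₁ B₁) (inj₂ L₂) (inj₂ L₃) =
    FiniteBelow-removal-unique big d₂₃ L₂ L₃
  at-most-two-collapsing big d₁₂ d₁₃ d₂₃ (inj₂ L₁) (inj₁ B₂) (inj₁ B₃) = B≤M-removal-unique big d₂₃ B₂ B₃
  at-most-two-collapsing big d₁₂ d₁₃ d₂₃ (inj₂ L₁) (inj₁ B₂) (inj₂ L₃) =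
    FiniteBelow-removal-unique big d₁₃ L₁ L₃

  Diagonalises : TuringFunctional → Baire → List Baire → MassProblem → MassProblem → Set
  Diagonalises Ψ b F X₀ X = X ⊆ X₀ × Big X × (_∈ F) ⊆ X × Ψ ⟨ b ⟩∉ X

  diagonalise : ∀ {X₀ X₁ : MassProblem} F → X₀ ⊆ A → Big X₀ → (_∈ F) ⊆ X₀ → Big X₁ → ∀ Ψ →
                Σ Baire λ b → X₁ b × Σ MassProblem (Diagonalises Ψ b F X₀)
  diagonalise {X₀} {X₁} F X₀⊆A big₀ F⊆X₀ big₁ Ψ = dne₁ Refutation.absurd
    where
    module Refutation (none : ¬ Σ Baire λ b → X₁ b × Σ MassProblem (Diagonalises Ψ b F X₀)) where
      lands : ∀ {b} → X₁ b → Σ Baire λ g → Ψ computes g from b × X₀ g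
      lands {b} X₁b = dne λ ¬lands →
        none (b , X₁b , X₀ , id , big₀ , F⊆X₀ , λ g Ψb↦g X₀g → ¬lands (g , Ψb↦g , X₀g))

      removal-collapses : ∀ {b g} → X₁ b → Ψ computes g from b → ¬ finiteMP F g →
                          Small (X₀ ∖ (g ≗_))
      removal-collapses {b} {g} X₁b Ψb↦g g∉F = ¬big⇒small λ big →
        none (b , X₁b , X₀ ∖ (g ≗_) , proj₁ , big , F⊆X₀∖g ,
              λ g′ Ψb↦g′ (_ , g≉g′) → g≉g′ (computes-unique Ψb↦g Ψb↦g′))
        where
        F⊆X₀∖g : (_∈ F) ⊆ (X₀ ∖ (g ≗_))
        F⊆X₀∖g f∈F = F⊆X₀ f∈F , λ g≗f → g∉F (lose f∈F (sym ∘ g≗f))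

      fresh-collapsing : ∀ L → (_∈ L) ⊆ A →
                         Σ Baire λ g → X₀ g × ¬ finiteMP (L ++ F) g × Small (X₀ ∖ (g ≗_))
      fresh-collapsing L L⊆A = dne λ ¬fresh →
        proj₂ big₁ (L ++ F , [ L⊆A , X₀⊆A ∘ F⊆X₀ ] ∘ ∈-++⁻ L , Ψ , reduce ¬fresh)
        where
        reduce : ¬ (Σ Baire λ g → X₀ g × ¬ finiteMP (L ++ F) g × Small (X₀ ∖ (g ≗_))) →
                 ∀ b → X₁ b → Σ Baire λ g → Ψ computes g from b × finiteMP (L ++ F) g
        reduce ¬fresh b X₁b =
          let g , Ψb↦g , X₀g = lands X₁b
          in g , Ψb↦g , dne λ g∉ → ¬fresh (g , X₀g , g∉ , removal-collapses X₁b Ψb↦g (g∉ ∘ ++⁺ʳ L))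

      absurd : ⊥
      absurd =
        let g₁ , X₀g₁ , g₁∉ , small₁ = fresh-collapsing [] λ ()
            g₂ , X₀g₂ , g₂∉ , small₂ = fresh-collapsing (g₁ ∷ []) λ { (here refl) → X₀⊆A X₀g₁ }
            g₃ , _    , g₃∉ , small₃ = fresh-collapsing (g₁ ∷ g₂ ∷ [])
              λ { (here refl) → X₀⊆A X₀g₁ ; (there (here refl)) → X₀⊆A X₀g₂ }
        in at-most-two-collapsing big₀ (g₂∉ ∘ here) (g₃∉ ∘ here) (g₃∉ ∘ there ∘ here)
             small₁ small₂ small₃

  record Side : Set₁ where
    constructor side
    field
      members      : List Baire
      pool         : MassProblem
      pool⊆A       : pool ⊆ A
      pool-big     : Big pool
      members⊆pool : (_∈ members) ⊆ pool
  open Side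

  admit : ∀ {f} (s : Side) → pool s f → Side
  admit {f} s f∈pool = side (f ∷ members s) (pool s) (pool⊆A s) (pool-big s)
    λ { (here refl) → f∈pool ; (there f′∈) → members⊆pool s f′∈ }

  restrict : ∀ (s : Side) X → X ⊆ pool s → Big X → (_∈ members s) ⊆ X → Side
  restrict s X X⊆pool X-big members⊆X = side (members s) X (pool⊆A s ∘ X⊆pool) X-big members⊆X

  record _≼_ (s t : Side) : Set where
    constructor refines
    field
      members-⊆ : (_∈ members s) ⊆ (_∈ members t)
      pool-⊇    : pool t ⊆ pool s
  open _≼_

  ≼-refl : ∀ {s} → s ≼ s
  ≼-refl = refines id id

  ≼-trans : ∀ {s t u} → s ≼ t → t ≼ u → s ≼ u
  ≼-trans (refines members-⊆ pool-⊇) (refines members-⊆′ pool-⊇′) =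
    refines (members-⊆′ ∘ members-⊆) (pool-⊇ ∘ pool-⊇′)

  Stage : Set₁
  Stage = Side × Side

  record _⊑_ (σ τ : Stage) : Set where
    constructor both
    field
      side₀ : proj₁ σ ≼ proj₁ τ
      side₁ : proj₂ σ ≼ proj₂ τ
  open _⊑_

  ⊑-refl : ∀ {σ} → σ ⊑ σ
  ⊑-refl = both ≼-refl ≼-refl

  ⊑-trans : ∀ {σ τ υ} → σ ⊑ τ → τ ⊑ υ → σ ⊑ υ
  ⊑-trans (both ≼₀ ≼₁) (both ≼₀′ ≼₁′) = both (≼-trans ≼₀ ≼₀′) (≼-trans ≼₁ ≼₁′)

  ⊑-swap : ∀ {σ τ} → σ ⊑ τ → swap σ ⊑ swap τ
  ⊑-swap (both ≼₀ ≼₁) = both ≼₁ ≼₀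

  -- As C₀ lies inside every pool of side 0, Ψ then reduces neither B to C₀ nor C₀ to C₁.
  Defeated : TuringFunctional → Stage → Set
  Defeated Ψ (s₀ , s₁) = (Σ Baire λ f → f ∈ members s₀ × Ψ ⟨ f ⟩∉ B)
                       × (Σ Baire λ b → b ∈ members s₁ × Ψ ⟨ b ⟩∉ pool s₀)

  Defeated-mono : ∀ {Ψ σ τ} → σ ⊑ τ → Defeated Ψ σ → Defeated Ψ τ
  Defeated-mono (both (refines members-⊆₀ pool-⊇₀) (refines members-⊆₁ _))
                ((f , f∈ , Ψf∉B) , (b , b∈ , Ψb∉pool)) =
    (f , members-⊆₀ f∈ , Ψf∉B) , (b , members-⊆₁ b∈ , λ g Ψb↦g → Ψb∉pool g Ψb↦g ∘ pool-⊇₀)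

  defeat : ∀ Ψ σ → Σ Stage λ τ → σ ⊑ τ × Defeated Ψ τ
  defeat Ψ (s₀ , s₁) =
    let f , f∈pool₀ , Ψf∉B = ≰M⇒witness (proj₁ (pool-big s₀)) Ψ
        s₀′ = admit s₀ f∈pool₀
        b , b∈pool₁ , X , X⊆pool₀ , X-big , members⊆X , Ψb∉X =
          diagonalise (members s₀′) (pool⊆A s₀′) (pool-big s₀′) (members⊆pool s₀′) (pool-big s₁) Ψ
    in (restrict s₀′ X X⊆pool₀ X-big members⊆X , admit s₁ b∈pool₁) ,
       both (refines there X⊆pool₀) (refines there id) ,
       (f , here refl , Ψf∉B) , (b , here refl , Ψb∉X)

  Requirement : TuringFunctional → Stage → Set
  Requirement Ψ σ = Defeated Ψ σ × Defeated Ψ (swap σ)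

  Requirement-mono : ∀ {Ψ σ τ} → σ ⊑ τ → Requirement Ψ σ → Requirement Ψ τ
  Requirement-mono σ⊑τ (defeated , defeated′) =
    Defeated-mono σ⊑τ defeated , Defeated-mono (⊑-swap σ⊑τ) defeated′

  meet : ∀ Ψ σ → Σ Stage λ τ → σ ⊑ τ × Requirement Ψ τ
  meet Ψ σ =
    let τ , σ⊑τ , defeated = defeat Ψ σ
        υ , τ⊑υ , defeated′ = defeat Ψ (swap τ)
    in swap υ , ⊑-trans σ⊑τ (⊑-swap τ⊑υ) , Defeated-mono (⊑-swap τ⊑υ) defeated , defeated′

  meet-all : ∀ Ψs σ → Σ Stage λ τ → σ ⊑ τ × (∀ {Ψ} → Ψ ∈ Ψs → Requirement Ψ τ)
  meet-all []       σ = σ , ⊑-refl , λ ()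
  meet-all (Ψ ∷ Ψs) σ =
    let τ , σ⊑τ , met = meet Ψ σ
        υ , τ⊑υ , all-met = meet-all Ψs τ
    in υ , ⊑-trans σ⊑τ τ⊑υ ,
       λ { (here refl) → Requirement-mono τ⊑υ met ; (there Ψ∈) → all-met Ψ∈ }

  initial : Side
  initial = side [] A id big-A λ ()

  stage : ℕ → Stage
  stage zero    = initial , initial
  stage (suc s) = proj₁ (meet-all (programs s 1) (stage s))

  stage-mono : ∀ {s t} → s ≤′ t → stage s ⊑ stage t
  stage-mono ≤′-refl            = ⊑-refl
  stage-mono (≤′-step {t} s≤′t) =
    ⊑-trans (stage-mono s≤′t) (proj₁ (proj₂ (meet-all (programs t 1) (stage t))))

  requirement-met : ∀ Ψ → ∃ λ s → Requirement Ψ (stage s)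
  requirement-met Ψ =
    let s , Ψ∈ = programs-complete Ψ
    in suc s , proj₂ (proj₂ (meet-all (programs s 1) (stage s))) (Ψ∈ s ≤-refl)

  swapped-stage-mono : ∀ {s t} → s ≤′ t → swap (stage s) ⊑ swap (stage t)
  swapped-stage-mono s≤′t = ⊑-swap (stage-mono s≤′t)

  stage-defeats : ∀ Ψ → ∃ λ s → Defeated Ψ (stage s)
  stage-defeats = map₂ proj₁ ∘ requirement-met

  swapped-stage-defeats : ∀ Ψ → ∃ λ s → Defeated Ψ (swap (stage s))
  swapped-stage-defeats = map₂ proj₂ ∘ requirement-met

  module Limit (σ : ℕ → Stage) (σ-mono : ∀ {s t} → s ≤′ t → σ s ⊑ σ t)
               (defeated : ∀ Ψ → ∃ λ s → Defeated Ψ (σ s)) where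
    C₀ C₁ : MassProblem
    C₀ f = ∃ λ s → f ∈ members (proj₁ (σ s))
    C₁ f = ∃ λ s → f ∈ members (proj₂ (σ s))

    C₀⊆pool : ∀ s → C₀ ⊆ pool (proj₁ (σ s))
    C₀⊆pool s (t , f∈) =
      pool-⊇ (side₀ (σ-mono (≤⇒≤′ (m≤m⊔n s t))))
        (members⊆pool (proj₁ (σ (s ⊔ t))) (members-⊆ (side₀ (σ-mono (≤⇒≤′ (m≤n⊔m s t)))) f∈))

    A≤C₀ : A ≤M C₀
    A≤C₀ = ⊆⇒≤M λ C₀f → pool⊆A (proj₁ (σ 0)) (C₀⊆pool 0 C₀f)

    B≰C₀ : ¬ B ≤M C₀
    B≰C₀ (Ψ , reduce) =
      let s , (f , f∈ , Ψf∉B) , _ = defeated Ψ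
          g , Ψf↦g , Bg = reduce f (s , f∈)
      in Ψf∉B g Ψf↦g Bg

    C₀≰C₁ : ¬ C₀ ≤M C₁
    C₀≰C₁ (Ψ , reduce) =
      let s , _ , (b , b∈ , Ψb∉pool) = defeated Ψ
          g , Ψb↦g , C₀g = reduce b (s , b∈)
      in Ψb∉pool g Ψb↦g (C₀⊆pool s C₀g)

  open Limit stage stage-mono stage-defeats public
  -- Swapped.C₀ is C₁.
  module Swapped = Limit (swap ∘ stage) swapped-stage-mono swapped-stage-defeats

proposition8p6 : ExcludedMiddle (Level.suc 0ℓ) →
    (A B : MassProblem) → ¬ FiniteDegree A → ¬ (B ≤M A) →
    Σ MassProblem λ C₀ → Σ MassProblem λ C₁ →
      (A ≤M C₀) × (A ≤M C₁) × Incomparable C₀ C₁ × ¬ (B ≤M C₀) × ¬ (B ≤M C₁)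
proposition8p6 em A B A-not-finite B≰A =
  C₀ , C₁ , A≤C₀ , Swapped.A≤C₀ , (C₀≰C₁ , Swapped.C₀≰C₁) , B≰C₀ , Swapped.B≰C₀
  where open Construction em A B A-not-finite B≰A
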